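{- For every $i\ge1$ and $w\in\mathfrak{h}^1$, $d_q(z_i\circ w)=z_i\circ d_q(w)$.
   Context: Let $\hbar$ be an indeterminate and $\mathcal{C}=\mathbb{Q}[\hbar]$. Let $\mathfrak{h}^1$ be the non-commutative polynomial algebra over $\mathcal{C}$ freely generated by letters $z_1,z_2,\dots$; juxtaposition is concatenation. Products on letters: $z_i\circ z_j=z_{i+j}$, $z_i\circ_+z_j=z_{i+j}+\hbar z_{i+j-1}$; actions on $\mathfrak{h}^1$: $z_i\circ1=0$, $z_i\circ(z_jw)=(z_i\circ z_j)w$, and likewise $z_i\circ_+1=0$, $z_i\circ_+(z_jw)=(z_i\circ_+z_j)w$, extended $\mathcal{C}$-bilinearly. The $\mathcal{C}$-linear map $d_q:\mathfrak{h}^1\to\mathfrak{h}^1$: $d_q(1)=1$, $d_q(z_iw)=z_i\,d_q(w)+z_i\circ_+d_q(w)$. -}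

module Defs where

open import Data.Nat as ℕ using (ℕ; zero; suc)
open import Data.Rational as ℚ using (ℚ; 0ℚ; 1ℚ)
open import Data.List using (List; []; _∷_; _++_; concatMap; map)
open import Data.List.Properties using (≡-dec)
open import Data.Product using (_×_; _,_)
open import Relation.Nullary using (yes; no)
open import Relation.Nullary.Decidable using (_×-dec_)
open import Relation.Binary.PropositionalEquality using (_≡_)

-- Letters z_1, z_2, ... : the constructor  z[1+ n ]  denotes the letter z_{n+1}.
data Letter : Set where
  z[1+_] : ℕ → Letter

index : Letter → ℕ
index z[1+ n ] = suc n

letter-≟ : (a b : Letter) → Relation.Nullary.Dec (a ≡ b)
letter-≟ z[1+ m ] z[1+ n ] with m ℕ.≟ n
... | yes Relation.Binary.PropositionalEquality.refl = yes Relation.Binary.PropositionalEquality.refl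
... | no m≢n = no λ { Relation.Binary.PropositionalEquality.refl → m≢n Relation.Binary.PropositionalEquality.refl }

-- Words (monomials) in the letters; juxtaposition is list concatenation.
Word : Set
Word = List Letter

-- A term  q · ħ^k · w  with q ∈ ℚ, k ∈ ℕ, w a word.  Since C = ℚ[ħ],
-- the monomials ħ^k w form a ℚ-basis of h^1.
Term : Set
Term = ℚ × ℕ × Word

-- An element of h^1 is a finite formal sum of terms.
H1 : Set
H1 = List Term

coeff : H1 → ℕ → Word → ℚ
coeff [] k w = 0ℚ
coeff ((q , m , v) ∷ xs) k w with (m ℕ.≟ k) ×-dec (≡-dec letter-≟ v w)
... | yes _ = q ℚ.+ coeff xs k w
... | no  _ = coeff xs k w

infix 4 _≈_
_≈_ : H1 → H1 → Set
x ≈ y = ∀ (k : ℕ) (w : Word) → coeff x k w ≡ coeff y k w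

scale : ℚ → ℕ → H1 → H1
scale q k = map λ { (p , m , v) → (q ℚ.* p , k ℕ.+ m , v) }

linear : (Word → H1) → H1 → H1
linear f = concatMap λ { (q , k , v) → scale q k (f v) }

prepend : Letter → H1 → H1
prepend a = map λ { (q , k , v) → (q , k , a ∷ v) }

-- z_i ∘ z_j = z_{i+j}
_∘ℓ_ : Letter → Letter → Letter
z[1+ m ] ∘ℓ z[1+ n ] = z[1+ suc (m ℕ.+ n) ]

∘-word : Letter → Word → H1
∘-word a [] = []
∘-word a (b ∷ w) = (1ℚ , 0 , (a ∘ℓ b) ∷ w) ∷ []

-- z_i ∘_+ 1 = 0,  z_i ∘_+ (z_j w) = z_{i+j} w + ħ z_{i+j-1} w, on words
∘₊-word : Letter → Word → H1
∘₊-word a [] = []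
∘₊-word z[1+ m ] (z[1+ n ] ∷ w) =
  (1ℚ , 0 , z[1+ suc (m ℕ.+ n) ] ∷ w) ∷ (1ℚ , 1 , z[1+ m ℕ.+ n ] ∷ w) ∷ []

infixr 6 _∘_ _∘₊_
_∘_ : Letter → H1 → H1
a ∘ x = linear (∘-word a) x

_∘₊_ : Letter → H1 → H1
a ∘₊ x = linear (∘₊-word a) x

dq-word : Word → H1
dq-word [] = (1ℚ , 0 , []) ∷ []
dq-word (a ∷ w) = prepend a (dq-word w) ++ (a ∘₊ dq-word w)

dq : H1 → H1
dq = linear dq-word

module Submission where

-- Every operator in the statement (z_i ∘ _, z_i ∘₊ _, d_q) is the C-linear
-- extension  linear f  of a map f on words, and elements of h¹ are compared
-- coefficientwise.  The proof has two layers.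
--
-- Word combinatorics: z_i ∘ _ commutes with prepending a letter and is
-- associative with ∘₊ ,  z_i ∘ (z_j ∘₊ u) = (z_i ∘ z_j) ∘₊ u .  Unfolding
-- d_q(z_j u) then gives the theorem on a single word:
--   d_q(z_i ∘ v) ≋ z_i ∘ d_q(v).
--
-- The theorem follows since both sides are composites of linear maps, and
-- these composites agree on words.

open import Defs
open import Data.Nat as ℕ using (_≤_; _≤?_)
import Data.Nat.Properties as ℕP
open import Data.Rational as ℚ using (0ℚ; 1ℚ)
import Data.Rational.Properties as ℚP
open import Data.List using ([]; _∷_; _++_)
open import Data.List.Properties using (≡-dec; map-++; concatMap-++; ++-identityʳ)
open import Data.Product using (_×_; _,_; map₁)
open import Data.Empty using (⊥-elim)
open import Function using (_∘′_)
open import Relation.Nullary using (yes; no; ¬_)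
open import Relation.Nullary.Decidable using (_×-dec_)
open import Relation.Binary.Bundles using (Setoid)
import Relation.Binary.Reasoning.Setoid as SetoidReasoning
open import Relation.Binary.PropositionalEquality

-- Coefficientwise equality, wrapped in a record so that both sides can be
-- inferred from a proof (the bare _≈_ unfolds to a function type).
record _≋_ (x y : H1) : Set where
  constructor mk
  field coeff-eq : x ≈ y
open _≋_

infix 4 _≋_

≋-setoid : Setoid _ _
≋-setoid = record
  { Carrier = H1
  ; _≈_ = _≋_
  ; isEquivalence = record
    { refl = mk λ _ _ → refl
    ; sym = λ (mk x≈y) → mk λ k w → sym (x≈y k w)
    ; trans = λ (mk x≈y) (mk y≈z) → mk λ k w → trans (x≈y k w) (y≈z k w)
    }
  }

open Setoid ≋-setoid
  using () renaming (refl to ≋-refl; sym to ≋-sym; trans to ≋-trans; reflexive to ≡⇒≋)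
module ≋-Reasoning = SetoidReasoning ≋-setoid

coeff-hit : ∀ q m v xs → coeff ((q , m , v) ∷ xs) m v ≡ q ℚ.+ coeff xs m v
coeff-hit q m v xs with (m ℕ.≟ m) ×-dec (≡-dec letter-≟ v v)
... | yes _ = refl
... | no miss = ⊥-elim (miss (refl , refl))

coeff-miss : ∀ q m v xs k w → ¬ (m ≡ k × v ≡ w) →
             coeff ((q , m , v) ∷ xs) k w ≡ coeff xs k w
coeff-miss q m v xs k w miss with (m ℕ.≟ k) ×-dec (≡-dec letter-≟ v w)
... | yes hit = ⊥-elim (miss hit)
... | no _ = refl

coeff-++ : ∀ x y k w → coeff (x ++ y) k w ≡ coeff x k w ℚ.+ coeff y k w
coeff-++ [] y k w = sym (ℚP.+-identityˡ _)
coeff-++ ((q , m , v) ∷ x) y k w with (m ℕ.≟ k) ×-dec (≡-dec letter-≟ v w)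
... | yes _ = trans (cong (q ℚ.+_) (coeff-++ x y k w)) (sym (ℚP.+-assoc q _ _))
... | no _ = coeff-++ x y k w

cons-cong : ∀ {t t' xs ys} → t ≡ t' → xs ≋ ys → t ∷ xs ≋ t' ∷ ys
cons-cong {t = q , m , v} {xs = xs} {ys} refl (mk xs≈ys) = mk coeffs
  where
  coeffs : (q , m , v) ∷ xs ≈ (q , m , v) ∷ ys
  coeffs k w with (m ℕ.≟ k) ×-dec (≡-dec letter-≟ v w)
  ... | yes _ = cong (q ℚ.+_) (xs≈ys k w)
  ... | no _ = xs≈ys k w

++-cong : ∀ {x x' y y'} → x ≋ x' → y ≋ y' → x ++ y ≋ x' ++ y'
++-cong {x} {x'} {y} {y'} (mk x≈x') (mk y≈y') = mk λ k w → begin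
  coeff (x ++ y) k w               ≡⟨ coeff-++ x y k w ⟩
  coeff x k w ℚ.+ coeff y k w      ≡⟨ cong₂ ℚ._+_ (x≈x' k w) (y≈y' k w) ⟩
  coeff x' k w ℚ.+ coeff y' k w    ≡⟨ coeff-++ x' y' k w ⟨
  coeff (x' ++ y') k w             ∎
  where open ≡-Reasoning

scale-shift : ∀ q k x d w → coeff (scale q k x) (k ℕ.+ d) w ≡ q ℚ.* coeff x d w
scale-shift q k [] d w = sym (ℚP.*-zeroʳ q)
scale-shift q k ((p , m , v) ∷ x) d w with (m ℕ.≟ d) ×-dec (≡-dec letter-≟ v w)
... | yes (refl , refl) = begin
  coeff ((q ℚ.* p , k ℕ.+ m , v) ∷ scale q k x) (k ℕ.+ m) v
    ≡⟨ coeff-hit (q ℚ.* p) (k ℕ.+ m) v (scale q k x) ⟩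
  q ℚ.* p ℚ.+ coeff (scale q k x) (k ℕ.+ m) v
    ≡⟨ cong (q ℚ.* p ℚ.+_) (scale-shift q k x m v) ⟩
  q ℚ.* p ℚ.+ q ℚ.* coeff x m v
    ≡⟨ ℚP.*-distribˡ-+ q p (coeff x m v) ⟨
  q ℚ.* (p ℚ.+ coeff x m v)
    ∎
  where open ≡-Reasoning
... | no miss = trans
  (coeff-miss (q ℚ.* p) (k ℕ.+ m) v (scale q k x) (k ℕ.+ d) w
              (miss ∘′ map₁ (ℕP.+-cancelˡ-≡ k m d)))
  (scale-shift q k x d w)

scale-below : ∀ q k x {K} w → ¬ (k ≤ K) → coeff (scale q k x) K w ≡ 0ℚ
scale-below q k [] w k≰K = refl
scale-below q k ((p , m , v) ∷ x) w k≰K = trans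
  (coeff-miss (q ℚ.* p) (k ℕ.+ m) v (scale q k x) _ w
              (λ (k+m≡K , _) → k≰K (subst (k ≤_) k+m≡K (ℕP.m≤m+n k m))))
  (scale-below q k x w k≰K)

scale-cong : ∀ q k {x y} → x ≋ y → scale q k x ≋ scale q k y
scale-cong q k {x} {y} (mk x≈y) = mk coeffs
  where
  coeffs : scale q k x ≈ scale q k y
  coeffs K w with k ≤? K
  ... | no k≰K = trans (scale-below q k x w k≰K) (sym (scale-below q k y w k≰K))
  ... | yes k≤K with ℕP.m≤n⇒∃[o]m+o≡n k≤K
  ...   | d , refl = begin
    coeff (scale q k x) (k ℕ.+ d) w  ≡⟨ scale-shift q k x d w ⟩
    q ℚ.* coeff x d w                ≡⟨ cong (q ℚ.*_) (x≈y d w) ⟩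
    q ℚ.* coeff y d w                ≡⟨ scale-shift q k y d w ⟨
    coeff (scale q k y) (k ℕ.+ d) w  ∎
    where open ≡-Reasoning

scale-scale : ∀ q k p m y → scale q k (scale p m y) ≋ scale (q ℚ.* p) (k ℕ.+ m) y
scale-scale q k p m [] = ≋-refl
scale-scale q k p m ((r , n , v) ∷ y) =
  cons-cong (cong₂ (λ a b → (a , b , v)) (sym (ℚP.*-assoc q p r)) (sym (ℕP.+-assoc k m n)))
            (scale-scale q k p m y)

scale-identity : ∀ x → scale 1ℚ 0 x ≋ x
scale-identity [] = ≋-refl
scale-identity ((p , m , v) ∷ x) =
  cons-cong (cong (λ a → (a , m , v)) (ℚP.*-identityˡ p)) (scale-identity x)

linear-++ : ∀ f x y → linear f (x ++ y) ≡ linear f x ++ linear f y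
linear-++ f = concatMap-++ _

linear-scale : ∀ f q k x → linear f (scale q k x) ≋ scale q k (linear f x)
linear-scale f q k [] = ≋-refl
linear-scale f q k ((p , m , v) ∷ x) = begin
  scale (q ℚ.* p) (k ℕ.+ m) (f v) ++ linear f (scale q k x)
    ≈⟨ ++-cong (≋-sym (scale-scale q k p m (f v))) (linear-scale f q k x) ⟩
  scale q k (scale p m (f v)) ++ scale q k (linear f x)
    ≡⟨ map-++ _ (scale p m (f v)) (linear f x) ⟨
  scale q k (scale p m (f v) ++ linear f x)
    ∎
  where open ≋-Reasoning

linear-basis : ∀ f v → linear f ((1ℚ , 0 , v) ∷ []) ≋ f v
linear-basis f v = ≋-trans (≡⇒≋ (++-identityʳ (scale 1ℚ 0 (f v)))) (scale-identity (f v))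

linear-cong : ∀ {f g} → (∀ v → f v ≋ g v) → ∀ x → linear f x ≋ linear g x
linear-cong f≋g [] = ≋-refl
linear-cong f≋g ((q , k , v) ∷ x) = ++-cong (scale-cong q k (f≋g v)) (linear-cong f≋g x)

linear-compose : ∀ f g x → linear f (linear g x) ≋ linear (λ v → linear f (g v)) x
linear-compose f g [] = ≋-refl
linear-compose f g ((q , k , v) ∷ x) = begin
  linear f (scale q k (g v) ++ linear g x)
    ≡⟨ linear-++ f (scale q k (g v)) (linear g x) ⟩
  linear f (scale q k (g v)) ++ linear f (linear g x)
    ≈⟨ ++-cong (linear-scale f q k (g v)) (linear-compose f g x) ⟩
  scale q k (linear f (g v)) ++ linear (λ u → linear f (g u)) x
    ∎
  where open ≋-Reasoning

-- z_i ∘⁻ z_j = z_{i+j-1}, the letter carrying the ħ-correction in ∘₊.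
_∘ℓ⁻_ : Letter → Letter → Letter
z[1+ m ] ∘ℓ⁻ z[1+ n ] = z[1+ m ℕ.+ n ]

∘₊-word-cons : ∀ a c v →
  ∘₊-word a (c ∷ v) ≡ (1ℚ , 0 , (a ∘ℓ c) ∷ v) ∷ (1ℚ , 1 , (a ∘ℓ⁻ c) ∷ v) ∷ []
∘₊-word-cons z[1+ m ] z[1+ n ] v = refl

∘ℓ-assoc : ∀ a b c → (a ∘ℓ b) ∘ℓ c ≡ a ∘ℓ (b ∘ℓ c)
∘ℓ-assoc z[1+ m ] z[1+ n ] z[1+ p ] =
  cong (λ j → z[1+ ℕ.suc j ]) (trans (cong ℕ.suc (ℕP.+-assoc m n p)) (sym (ℕP.+-suc m (n ℕ.+ p))))

∘ℓ-∘ℓ⁻-assoc : ∀ a b c → (a ∘ℓ b) ∘ℓ⁻ c ≡ a ∘ℓ (b ∘ℓ⁻ c)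
∘ℓ-∘ℓ⁻-assoc z[1+ m ] z[1+ n ] z[1+ p ] = cong (λ j → z[1+ ℕ.suc j ]) (ℕP.+-assoc m n p)

∘-prepend : ∀ i b D → i ∘ prepend b D ≋ prepend (i ∘ℓ b) D
∘-prepend i b [] = ≋-refl
∘-prepend i b ((q , k , v) ∷ D) =
  cons-cong (cong₂ (λ a c → (a , c , (i ∘ℓ b) ∷ v)) (ℚP.*-identityʳ q) (ℕP.+-identityʳ k))
            (∘-prepend i b D)

-- Associativity of ∘ with ∘₊ on words:  z_i ∘ (z_j ∘₊ v) = (z_i ∘ z_j) ∘₊ v.
-- (The coefficients 1ℚ ℚ.* 1ℚ produced by z_i ∘ _ compute to 1ℚ.)
∘-∘₊-word : ∀ i b v → i ∘ ∘₊-word b v ≋ ∘₊-word (i ∘ℓ b) v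
∘-∘₊-word i b [] = ≋-refl
∘-∘₊-word i b (c ∷ u) = begin
  i ∘ ∘₊-word b (c ∷ u)
    ≡⟨ cong (i ∘_) (∘₊-word-cons b c u) ⟩
  (1ℚ , 0 , (i ∘ℓ (b ∘ℓ c)) ∷ u) ∷ (1ℚ , 1 , (i ∘ℓ (b ∘ℓ⁻ c)) ∷ u) ∷ []
    ≡⟨ cong₂ (λ l l⁻ → (1ℚ , 0 , l ∷ u) ∷ (1ℚ , 1 , l⁻ ∷ u) ∷ [])
             (∘ℓ-assoc i b c) (∘ℓ-∘ℓ⁻-assoc i b c) ⟨
  (1ℚ , 0 , ((i ∘ℓ b) ∘ℓ c) ∷ u) ∷ (1ℚ , 1 , ((i ∘ℓ b) ∘ℓ⁻ c) ∷ u) ∷ []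
    ≡⟨ ∘₊-word-cons (i ∘ℓ b) c u ⟨
  ∘₊-word (i ∘ℓ b) (c ∷ u)
    ∎
  where open ≋-Reasoning

∘-∘₊ : ∀ i b D → i ∘ (b ∘₊ D) ≋ (i ∘ℓ b) ∘₊ D
∘-∘₊ i b D = ≋-trans (linear-compose (∘-word i) (∘₊-word b) D)
                     (linear-cong (∘-∘₊-word i b) D)

dq-∘-word : ∀ i v → dq (∘-word i v) ≋ i ∘ dq-word v
dq-∘-word i [] = ≋-refl
dq-∘-word i (b ∷ u) = begin
  dq ((1ℚ , 0 , (i ∘ℓ b) ∷ u) ∷ [])
    ≈⟨ linear-basis dq-word ((i ∘ℓ b) ∷ u) ⟩
  prepend (i ∘ℓ b) D ++ (i ∘ℓ b) ∘₊ D
    ≈⟨ ++-cong (≋-sym (∘-prepend i b D)) (≋-sym (∘-∘₊ i b D)) ⟩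
  i ∘ prepend b D ++ i ∘ (b ∘₊ D)
    ≡⟨ linear-++ (∘-word i) (prepend b D) (b ∘₊ D) ⟨
  i ∘ (prepend b D ++ b ∘₊ D)
    ∎
  where
  D : H1
  D = dq-word u
  open ≋-Reasoning

lemma2p4 : ∀ (i : Letter) (w : H1) → dq (i ∘ w) ≈ i ∘ dq w
lemma2p4 i w = coeff-eq (begin
  dq (i ∘ w)                         ≈⟨ linear-compose dq-word (∘-word i) w ⟩
  linear (λ v → dq (∘-word i v)) w   ≈⟨ linear-cong (dq-∘-word i) w ⟩
  linear (λ v → i ∘ dq-word v) w     ≈⟨ linear-compose (∘-word i) dq-word w ⟨
  i ∘ dq w                           ∎)
  where open ≋-Reasoning
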